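{- The Klein four-group $\mathbf C_2\times\mathbf C_2$ is the only non-trivial finite group $\mathbf G$ (up to isomorphism) such that $\Aut(\mathbf G)=\Aut(\mathcal G_e(\mathbf G))$.
   Context: The enhanced power graph $\mathcal G_e(\mathbf G)$ of a group $\mathbf G$ is the simple graph on $G$ in which distinct $x,y$ are adjacent iff there is $z\in G$ with $x,y\in\langle z\rangle$. Both $\Aut(\mathbf G)$ (group automorphisms) and $\Aut(\mathcal G_e(\mathbf G))$ (graph automorphisms) are regarded as sets of permutations of $G$. -}

module Defs where

open import Data.Nat using (ℕ; zero; suc)
open import Data.Fin using (Fin; zero; suc)
open import Data.Bool using (Bool; true; false; _xor_)
open import Data.Bool.Properties using (xor-assoc; xor-identityˡ; xor-identityʳ; xor-same)
open import Data.Product using (Σ; ∃; _×_; _,_; proj₁; proj₂)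
open import Relation.Binary.PropositionalEquality using (_≡_; refl; cong₂)
open import Relation.Nullary using (¬_)
open import Algebra.Structures using (IsGroup)
open import Function.Bundles using (_↔_; mk↔ₛ′; _⇔_)
open import Function.Definitions using (Bijective)

record FinGroup : Set₁ where
  infixl 7 _∙_
  field
    Carrier : Set
    _∙_     : Carrier → Carrier → Carrier
    ε       : Carrier
    _⁻¹     : Carrier → Carrier
    isGroup : IsGroup _≡_ _∙_ ε _⁻¹
    size    : ℕ
    enum    : Carrier ↔ Fin size

  pow : Carrier → ℕ → Carrier
  pow z zero    = ε
  pow z (suc k) = z ∙ pow z k

  -- x ∈ ⟨ z ⟩  (cyclic subgroup of a finite group = set of natural powers)
  _∈⟨_⟩ : Carrier → Carrier → Set
  x ∈⟨ z ⟩ = ∃ λ k → pow z k ≡ x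

  Adj : Carrier → Carrier → Set
  Adj x y = ¬ (x ≡ y) × ∃ λ z → (x ∈⟨ z ⟩) × (y ∈⟨ z ⟩)

  NonTrivial : Set
  NonTrivial = ∃ λ x → ¬ (x ≡ ε)

  IsGroupAut : (Carrier → Carrier) → Set
  IsGroupAut f = Bijective _≡_ _≡_ f × (∀ x y → f (x ∙ y) ≡ f x ∙ f y)

  IsGraphAut : (Carrier → Carrier) → Set
  IsGraphAut f = Bijective _≡_ _≡_ f × (∀ x y → Adj x y ⇔ Adj (f x) (f y))

open FinGroup

_≅_ : FinGroup → FinGroup → Set
G ≅ H = Σ (Carrier G → Carrier H) λ φ →
          Bijective _≡_ _≡_ φ × (∀ x y → φ (_∙_ G x y) ≡ _∙_ H (φ x) (φ y))

private
  K = Bool × Bool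

  _⊕_ : K → K → K
  (a , b) ⊕ (c , d) = (a xor c , b xor d)

  e : K
  e = (false , false)

  inv : K → K
  inv x = x

  kAssoc : ∀ x y z → (x ⊕ y) ⊕ z ≡ x ⊕ (y ⊕ z)
  kAssoc (a , b) (c , d) (u , v) = cong₂ _,_ (xor-assoc a c u) (xor-assoc b d v)

  kIdL : ∀ x → e ⊕ x ≡ x
  kIdL (a , b) = refl

  kIdR : ∀ x → x ⊕ e ≡ x
  kIdR (a , b) = cong₂ _,_ (xor-identityʳ a) (xor-identityʳ b)

  kInvL : ∀ x → inv x ⊕ x ≡ e
  kInvL (a , b) = cong₂ _,_ (xor-same a) (xor-same b)

  kInvR : ∀ x → x ⊕ inv x ≡ e
  kInvR (a , b) = cong₂ _,_ (xor-same a) (xor-same b)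

  kIsGroup : IsGroup _≡_ _⊕_ e inv
  kIsGroup = record
    { isMonoid = record
      { isSemigroup = record
        { isMagma = record
          { isEquivalence = Relation.Binary.PropositionalEquality.isEquivalence
          ; ∙-cong = λ { refl refl → refl } }
        ; assoc = kAssoc }
      ; identity = kIdL , kIdR }
    ; inverse = kInvL , kInvR
    ; ⁻¹-cong = λ { refl → refl } }

  to : K → Fin 4
  to (false , false) = zero
  to (false , true)  = suc zero
  to (true , false)  = suc (suc zero)
  to (true , true)   = suc (suc (suc zero))

  from : Fin 4 → K
  from zero                   = (false , false)
  from (suc zero)             = (false , true)
  from (suc (suc zero))       = (true , false)
  from (suc (suc (suc zero))) = (true , true)

  to∘from : ∀ i → to (from i) ≡ i
  to∘from zero                   = refl
  to∘from (suc zero)             = refl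
  to∘from (suc (suc zero))       = refl
  to∘from (suc (suc (suc zero))) = refl

  from∘to : ∀ x → from (to x) ≡ x
  from∘to (false , false) = refl
  from∘to (false , true)  = refl
  from∘to (true , false)  = refl
  from∘to (true , true)   = refl

Klein : FinGroup
Klein = record
  { Carrier = K ; _∙_ = _⊕_ ; ε = e ; _⁻¹ = inv ; isGroup = kIsGroup
  ; size = 4 ; enum = mk↔ₛ′ to from to∘from from∘to }

-- Group automorphisms always preserve the enhanced power graph. Conversely, exchanging two
-- vertices with the same neighbours ("twins") is a graph automorphism, so if Aut(G) = Aut(G_e(G))
-- every such transposition is a group automorphism. Transposing ε with a generator shows that G
-- is not cyclic; x and x⁻¹ are always twins, and transposing them then forces x = x⁻¹, so G has
-- exponent 2. There all non-identity elements are twins, and transposing a ∙ b with any element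
-- outside {ε, a, b, a ∙ b} shows that G = {ε, a, b, a ∙ b} is the Klein group. In the Klein group
-- the graph automorphisms are the permutations fixing ε, and these are group automorphisms
-- because the product of two distinct non-identity elements is the remaining one.
module Submission where

open import Defs
open import Algebra.Bundles using (Group; AbelianGroup)
open import Algebra.Structures using (IsGroup)
import Algebra.Properties.Group as GroupProperties
import Algebra.Properties.CommutativeSemigroup as CommutativeSemigroupProperties
open import Data.Bool using (Bool; true; false; _xor_)
open import Data.Fin using (toℕ)
import Data.Fin.Properties as Fin
open import Data.Nat using (zero; suc; _+_)
import Data.Nat.Properties as ℕ
open import Data.Product using (∃; _×_; _,_; proj₁; proj₂)
open import Data.Sum using (_⊎_; inj₁; inj₂)
open import Function using (_∘_)
open import Function.Bundles using (_⇔_; mk⇔; Equivalence; Injection; Inverse)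
open import Function.Consequences.Propositional using (strictlySurjective⇒surjective)
open import Function.Definitions using (Injective; Surjective; StrictlySurjective; Bijective)
import Function.Construct.Symmetry as Symmetry
open import Function.Properties.Inverse using (↔⇒↣)
open import Level using (0ℓ)
open import Relation.Binary.Definitions using (DecidableEquality)
open import Relation.Binary.PropositionalEquality
open import Relation.Nullary using (¬_; yes; no; contradiction)
open import Relation.Nullary.Decidable using (via-injection; decidable-stable; _⊎-dec_)
open import Relation.Unary using (Decidable)

Homomorphic : (G H : FinGroup) → (FinGroup.Carrier G → FinGroup.Carrier H) → Set
Homomorphic G H φ = ∀ x y → φ (FinGroup._∙_ G x y) ≡ FinGroup._∙_ H (φ x) (φ y)

module FinGroupProperties (G : FinGroup) where
  open FinGroup G
  open IsGroup isGroup public using (assoc; identityˡ; identityʳ; inverseʳ)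

  group : Group 0ℓ 0ℓ
  group = record { isGroup = isGroup }

  open GroupProperties group public
    using (∙-cancelˡ; ∙-cancelʳ; identityˡ-unique; identityʳ-unique; inverseˡ-unique; inverseʳ-unique; ⁻¹-involutive; ε⁻¹≈ε; y≈x\\z)

  infix 4 _≟_
  -- Opaque, so that with-abstracting over x ≟ u still finds it in goals mentioning transpose.
  opaque
    _≟_ : DecidableEquality Carrier
    _≟_ = via-injection (↔⇒↣ enum) Fin._≟_

  ¬∀⇒∃¬ : {P : Carrier → Set} → Decidable P → ¬ (∀ x → P x) → ∃ λ x → ¬ P x
  ¬∀⇒∃¬ {P} P? ¬∀P
    with Fin.¬∀⟶∃¬ size (P ∘ from) (P? ∘ from) (λ ∀P → ¬∀P λ x → subst P (strictlyInverseʳ x) (∀P (to x)))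
    where open Inverse enum
  ... | i , ¬Pi = Inverse.from enum i , ¬Pi

  pow-+ : ∀ z i j → pow z i ∙ pow z j ≡ pow z (i + j)
  pow-+ z zero    j = identityˡ (pow z j)
  pow-+ z (suc i) j = trans (assoc z (pow z i) (pow z j)) (cong (z ∙_) (pow-+ z i j))

  finite-order : ∀ z → ∃ λ n → pow z (suc n) ≡ ε
  finite-order z
    with Fin.pigeonhole (ℕ.n<1+n size) (λ i → Inverse.to enum (pow z (toℕ i)))
  ... | i , j , i<j , same-index with ℕ.m≤n⇒∃[o]m+o≡n i<j
  ... | d , i+1+d≡j = d , ∙-cancelˡ (pow z (toℕ i)) (pow z (suc d)) ε (begin
    pow z (toℕ i) ∙ pow z (suc d)   ≡⟨ pow-+ z (toℕ i) (suc d) ⟩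
    pow z (toℕ i + suc d)           ≡⟨ cong (pow z) (trans (ℕ.+-suc (toℕ i) d) i+1+d≡j) ⟩
    pow z (toℕ j)                   ≡⟨ Injection.injective (↔⇒↣ enum) same-index ⟨
    pow z (toℕ i)                   ≡⟨ identityʳ (pow z (toℕ i)) ⟨
    pow z (toℕ i) ∙ ε               ∎)
    where open ≡-Reasoning

  ε∈⟨⟩ : ∀ {z} → ε ∈⟨ z ⟩
  ε∈⟨⟩ = 0 , refl

  ∈⟨self⟩ : ∀ z → z ∈⟨ z ⟩
  ∈⟨self⟩ z = 1 , identityʳ z

  ε⊎self∈⟨⟩ : ∀ {y z} → y ≡ ε ⊎ y ≡ z → y ∈⟨ z ⟩
  ε⊎self∈⟨⟩ (inj₁ refl) = ε∈⟨⟩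
  ε⊎self∈⟨⟩ (inj₂ refl) = ∈⟨self⟩ _

  ∙∈⟨⟩ : ∀ {x y z} → x ∈⟨ z ⟩ → y ∈⟨ z ⟩ → (x ∙ y) ∈⟨ z ⟩
  ∙∈⟨⟩ {z = z} (i , refl) (j , refl) = i + j , sym (pow-+ z i j)

  pow∈⟨⟩ : ∀ {x z} → x ∈⟨ z ⟩ → ∀ m → pow x m ∈⟨ z ⟩
  pow∈⟨⟩ x∈ zero    = ε∈⟨⟩
  pow∈⟨⟩ x∈ (suc m) = ∙∈⟨⟩ x∈ (pow∈⟨⟩ x∈ m)

  ⁻¹∈⟨⟩ : ∀ {x z} → x ∈⟨ z ⟩ → (x ⁻¹) ∈⟨ z ⟩
  ⁻¹∈⟨⟩ {x} x∈ =
    let n , xⁿ⁺¹≡ε = finite-order x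
    in subst (_∈⟨ _ ⟩) (inverseʳ-unique x (pow x n) xⁿ⁺¹≡ε) (pow∈⟨⟩ x∈ n)

  x∙y≢x : ∀ {x y} → y ≢ ε → x ∙ y ≢ x
  x∙y≢x {x} {y} y≢ε = y≢ε ∘ identityʳ-unique x y

  x∙y≢y : ∀ {x y} → x ≢ ε → x ∙ y ≢ y
  x∙y≢y {x} {y} x≢ε = x≢ε ∘ identityˡ-unique x y

  x≢x⁻¹⇒x≢ε : ∀ {x} → x ≢ x ⁻¹ → x ≢ ε
  x≢x⁻¹⇒x≢ε x≢x⁻¹ x≡ε = x≢x⁻¹ (trans x≡ε (sym (trans (cong _⁻¹ x≡ε) ε⁻¹≈ε)))

  Adj-sym : ∀ {x y} → Adj x y → Adj y x
  Adj-sym (x≢y , z , x∈ , y∈) = x≢y ∘ sym , z , y∈ , x∈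

  Adj-irrefl : ∀ {x} → ¬ Adj x x
  Adj-irrefl (x≢x , _) = x≢x refl

  Dominating : Carrier → Set
  Dominating u = ∀ w → w ≢ u → Adj u w

  ε-dominating : Dominating ε
  ε-dominating w w≢ε = w≢ε ∘ sym , w , ε∈⟨⟩ , ∈⟨self⟩ w

  generator-dominating : ∀ {u} → (∀ y → y ∈⟨ u ⟩) → Dominating u
  generator-dominating {u} generates w w≢u = w≢u ∘ sym , u , ∈⟨self⟩ u , generates w

  graphAut-dominating : ∀ {f u} → IsGraphAut f → Dominating u → Dominating (f u)
  graphAut-dominating {f} {u} ((_ , f-surjective) , f-Adj) u-dominating w w≢fu =
    let x , fx≡w = f-surjective w
    in subst (Adj (f u)) (fx≡w refl)
         (Equivalence.to (f-Adj u x) (u-dominating x λ x≡u → w≢fu (trans (sym (fx≡w refl)) (cong f x≡u))))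

  Twins : Carrier → Carrier → Set
  Twins u v = ∀ w → w ≢ u → w ≢ v → Adj u w ⇔ Adj v w

  dominating-twins : ∀ {u v} → Dominating u → Dominating v → Twins u v
  dominating-twins u-dominating v-dominating w w≢u w≢v =
    mk⇔ (λ _ → v-dominating w w≢v) (λ _ → u-dominating w w≢u)

  inverse-twins : ∀ x → Twins x (x ⁻¹)
  inverse-twins x w w≢x w≢x⁻¹ = mk⇔
    (λ (_ , z , x∈ , w∈) → w≢x⁻¹ ∘ sym , z , ⁻¹∈⟨⟩ x∈ , w∈)
    (λ (_ , z , x⁻¹∈ , w∈) → w≢x ∘ sym , z , subst (_∈⟨ z ⟩) (⁻¹-involutive x) (⁻¹∈⟨⟩ x⁻¹∈) , w∈)

  transpose : Carrier → Carrier → Carrier → Carrier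
  transpose u v x with x ≟ u | x ≟ v
  ... | yes _ | _     = v
  ... | no _  | yes _ = u
  ... | no _  | no _  = x

  data TransposeView (u v x : Carrier) : Set where
    at-u  : x ≡ u → transpose u v x ≡ v → TransposeView u v x
    at-v  : x ≡ v → transpose u v x ≡ u → TransposeView u v x
    other : x ≢ u → x ≢ v → transpose u v x ≡ x → TransposeView u v x

  transpose-u : ∀ u v → transpose u v u ≡ v
  transpose-u u v with u ≟ u
  ... | yes _   = refl
  ... | no u≢u = contradiction refl u≢u

  transpose-v : ∀ {u v} → u ≢ v → transpose u v v ≡ u
  transpose-v {u} {v} u≢v with v ≟ u | v ≟ v
  ... | yes v≡u | _      = contradiction (sym v≡u) u≢v
  ... | no _    | yes _  = refl
  ... | no _    | no v≢v = contradiction refl v≢v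

  transpose-other : ∀ {u v x} → x ≢ u → x ≢ v → transpose u v x ≡ x
  transpose-other {u} {v} {x} x≢u x≢v with x ≟ u | x ≟ v
  ... | yes x≡u | _       = contradiction x≡u x≢u
  ... | no _    | yes x≡v = contradiction x≡v x≢v
  ... | no _    | no _    = refl

  transpose-view : ∀ u v x → TransposeView u v x
  transpose-view u v x with x ≟ u | x ≟ v
  ... | yes refl | _        = at-u refl (transpose-u u v)
  ... | no x≢u   | yes refl = at-v refl (transpose-v (x≢u ∘ sym))
  ... | no x≢u   | no x≢v   = other x≢u x≢v (transpose-other x≢u x≢v)

  transpose-involutive : ∀ {u v} → u ≢ v → ∀ x → transpose u v (transpose u v x) ≡ x
  transpose-involutive {u} {v} u≢v x with transpose-view u v x
  ... | at-u refl τx≡v = trans (cong (transpose u v) τx≡v) (transpose-v u≢v)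
  ... | at-v refl τx≡u = trans (cong (transpose u v) τx≡u) (transpose-u u v)
  ... | other _ _ τx≡x = trans (cong (transpose u v) τx≡x) τx≡x

  transpose-bijective : ∀ {u v} → u ≢ v → Bijective _≡_ _≡_ (transpose u v)
  transpose-bijective {u} {v} u≢v = injective , surjective
    where
    injective : Injective _≡_ _≡_ (transpose u v)
    injective {x} {y} τx≡τy =
      trans (sym (transpose-involutive u≢v x)) (trans (cong (transpose u v) τx≡τy) (transpose-involutive u≢v y))
    surjective : Surjective _≡_ _≡_ (transpose u v)
    surjective y = transpose u v y , λ { refl → transpose-involutive u≢v y }

  transpose-Adj : ∀ {u v} → Twins u v → ∀ {x y} → Adj x y → Adj (transpose u v x) (transpose u v y)
  transpose-Adj {u} {v} twins {x} {y} x~y with transpose-view u v x | transpose-view u v y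
  ... | at-u refl _    | at-u refl _    = contradiction x~y Adj-irrefl
  ... | at-u refl τx≡v | at-v refl τy≡u = subst₂ Adj (sym τx≡v) (sym τy≡u) (Adj-sym x~y)
  ... | at-u refl τx≡v | other y≢u y≢v τy≡y =
    subst₂ Adj (sym τx≡v) (sym τy≡y) (Equivalence.to (twins y y≢u y≢v) x~y)
  ... | at-v refl τx≡u | at-u refl τy≡v = subst₂ Adj (sym τx≡u) (sym τy≡v) (Adj-sym x~y)
  ... | at-v refl _    | at-v refl _    = contradiction x~y Adj-irrefl
  ... | at-v refl τx≡u | other y≢u y≢v τy≡y =
    subst₂ Adj (sym τx≡u) (sym τy≡y) (Equivalence.from (twins y y≢u y≢v) x~y)
  ... | other x≢u x≢v τx≡x | at-u refl τy≡v =
    subst₂ Adj (sym τx≡x) (sym τy≡v) (Adj-sym (Equivalence.to (twins x x≢u x≢v) (Adj-sym x~y)))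
  ... | other x≢u x≢v τx≡x | at-v refl τy≡u =
    subst₂ Adj (sym τx≡x) (sym τy≡u) (Adj-sym (Equivalence.from (twins x x≢u x≢v) (Adj-sym x~y)))
  ... | other _ _ τx≡x | other _ _ τy≡y = subst₂ Adj (sym τx≡x) (sym τy≡y) x~y

  transpose-graphAut : ∀ {u v} → u ≢ v → Twins u v → IsGraphAut (transpose u v)
  transpose-graphAut {u} {v} u≢v twins = transpose-bijective u≢v , λ x y → mk⇔
    (transpose-Adj twins)
    (subst₂ Adj (transpose-involutive u≢v x) (transpose-involutive u≢v y) ∘ transpose-Adj twins)

  module Exponent2 (x∙x≡ε : ∀ x → x ∙ x ≡ ε) where

    ∙≡ε⇒≡ : ∀ {x y} → x ∙ y ≡ ε → x ≡ y
    ∙≡ε⇒≡ {x} {y} x∙y≡ε = trans (inverseˡ-unique x y x∙y≡ε) (sym (inverseʳ-unique y y (x∙x≡ε y)))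

    pow≡ε⊎pow≡self : ∀ z k → pow z k ≡ ε ⊎ pow z k ≡ z
    pow≡ε⊎pow≡self z zero = inj₁ refl
    pow≡ε⊎pow≡self z (suc k) with pow≡ε⊎pow≡self z k
    ... | inj₁ zᵏ≡ε = inj₂ (trans (cong (z ∙_) zᵏ≡ε) (identityʳ z))
    ... | inj₂ zᵏ≡z = inj₁ (trans (cong (z ∙_) zᵏ≡z) (x∙x≡ε z))

    Adj⇒ε : ∀ {x y} → Adj x y → x ≡ ε ⊎ y ≡ ε
    Adj⇒ε (x≢y , z , (i , refl) , (j , refl)) with pow≡ε⊎pow≡self z i | pow≡ε⊎pow≡self z j
    ... | inj₁ zⁱ≡ε | _         = inj₁ zⁱ≡ε
    ... | inj₂ _    | inj₁ zʲ≡ε = inj₂ zʲ≡ε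
    ... | inj₂ zⁱ≡z | inj₂ zʲ≡z = contradiction (trans zⁱ≡z (sym zʲ≡z)) x≢y

    dominating⇒ε : ∀ {u v} → Dominating u → v ≢ ε → v ≢ u → u ≡ ε
    dominating⇒ε {v = v} u-dominating v≢ε v≢u with Adj⇒ε (u-dominating v v≢u)
    ... | inj₁ u≡ε = u≡ε
    ... | inj₂ v≡ε = contradiction v≡ε v≢ε

    nonidentity-twins : ∀ {u v} → u ≢ ε → v ≢ ε → Twins u v
    nonidentity-twins u≢ε v≢ε w _ _ = mk⇔ (neighbour u≢ε v≢ε) (neighbour v≢ε u≢ε)
      where
      neighbour : ∀ {p q} → p ≢ ε → q ≢ ε → Adj p w → Adj q w
      neighbour {q = q} p≢ε q≢ε p~w with Adj⇒ε p~w
      ... | inj₁ p≡ε = contradiction p≡ε p≢ε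
      ... | inj₂ w≡ε = subst (Adj q) (sym w≡ε) (Adj-sym (ε-dominating q q≢ε))

    ∙-comm : ∀ x y → x ∙ y ≡ y ∙ x
    ∙-comm x y = ∙≡ε⇒≡ (begin
      (x ∙ y) ∙ (y ∙ x)   ≡⟨ assoc x y (y ∙ x) ⟩
      x ∙ (y ∙ (y ∙ x))   ≡⟨ cong (x ∙_) (assoc y y x) ⟨
      x ∙ ((y ∙ y) ∙ x)   ≡⟨ cong (λ t → x ∙ (t ∙ x)) (x∙x≡ε y) ⟩
      x ∙ (ε ∙ x)         ≡⟨ cong (x ∙_) (identityˡ x) ⟩
      x ∙ x               ≡⟨ x∙x≡ε x ⟩
      ε                   ∎)
      where open ≡-Reasoning

    abelianGroup : AbelianGroup 0ℓ 0ℓ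
    abelianGroup = record { isAbelianGroup = record { isGroup = isGroup ; comm = ∙-comm } }

    open CommutativeSemigroupProperties (AbelianGroup.commutativeSemigroup abelianGroup) public
      using (interchange)

    x∙y≢ε : ∀ {x y} → x ≢ y → x ∙ y ≢ ε
    x∙y≢ε x≢y = x≢y ∘ ∙≡ε⇒≡

module _ {G H : FinGroup} {φ : FinGroup.Carrier G → FinGroup.Carrier H} (φ-hom : Homomorphic G H φ) where
  private
    module G = FinGroup G
    module H = FinGroup H
    open FinGroupProperties H using (identityʳ-unique)

  hom-ε : φ G.ε ≡ H.ε
  hom-ε = identityʳ-unique (φ G.ε) (φ G.ε)
    (trans (sym (φ-hom G.ε G.ε)) (cong φ (IsGroup.identityˡ G.isGroup G.ε)))

  hom-pow : ∀ z k → φ (G.pow z k) ≡ H.pow (φ z) k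
  hom-pow z zero    = hom-ε
  hom-pow z (suc k) = trans (φ-hom z (G.pow z k)) (cong (φ z H.∙_) (hom-pow z k))

  hom-Adj : Injective _≡_ _≡_ φ → ∀ {x y} → G.Adj x y → H.Adj (φ x) (φ y)
  hom-Adj φ-injective (x≢y , z , (i , refl) , (j , refl)) =
    x≢y ∘ φ-injective , φ z , (i , sym (hom-pow z i)) , (j , sym (hom-pow z j))

  hom-≢ε : Injective _≡_ _≡_ φ → ∀ {x} → x ≢ G.ε → φ x ≢ H.ε
  hom-≢ε φ-injective x≢ε φx≡ε = x≢ε (φ-injective (trans φx≡ε (sym hom-ε)))

module BijectionInverse {G H : FinGroup} {φ : FinGroup.Carrier G → FinGroup.Carrier H}
               (φ-bijective : Bijective _≡_ _≡_ φ) where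
  private
    module G = FinGroup G
    module H = FinGroup H

  φ⁻¹ : H.Carrier → G.Carrier
  φ⁻¹ = proj₁ ∘ proj₂ φ-bijective

  φ∘φ⁻¹ : ∀ y → φ (φ⁻¹ y) ≡ y
  φ∘φ⁻¹ y = proj₂ (proj₂ φ-bijective y) refl

  φ⁻¹∘φ : ∀ x → φ⁻¹ (φ x) ≡ x
  φ⁻¹∘φ x = proj₁ φ-bijective (φ∘φ⁻¹ (φ x))

  φ⁻¹-bijective : Bijective _≡_ _≡_ φ⁻¹
  φ⁻¹-bijective = Symmetry.bijective φ-bijective refl sym trans (cong φ)

  φ⁻¹-hom : Homomorphic G H φ → Homomorphic H G φ⁻¹
  φ⁻¹-hom φ-hom x y = proj₁ φ-bijective (begin
    φ (φ⁻¹ (x H.∙ y))          ≡⟨ φ∘φ⁻¹ (x H.∙ y) ⟩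
    x H.∙ y                    ≡⟨ cong₂ H._∙_ (φ∘φ⁻¹ x) (φ∘φ⁻¹ y) ⟨
    φ (φ⁻¹ x) H.∙ φ (φ⁻¹ y)    ≡⟨ φ-hom (φ⁻¹ x) (φ⁻¹ y) ⟨
    φ (φ⁻¹ x G.∙ φ⁻¹ y)        ∎)
    where open ≡-Reasoning

≅-sym : ∀ {G H} → G ≅ H → H ≅ G
≅-sym {G} {H} (φ , φ-bijective , φ-hom) = φ⁻¹ , φ⁻¹-bijective , φ⁻¹-hom φ-hom
  where open BijectionInverse {G} {H} φ-bijective

groupAut⇒graphAut : ∀ G {f} → FinGroup.IsGroupAut G f → FinGroup.IsGraphAut G f
groupAut⇒graphAut G {f} (f-bijective , f-hom) = f-bijective , λ x y → mk⇔
  (hom-Adj f-hom (proj₁ f-bijective))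
  (subst₂ (FinGroup.Adj G) (φ⁻¹∘φ x) (φ⁻¹∘φ y) ∘ hom-Adj (φ⁻¹-hom f-hom) (proj₁ φ⁻¹-bijective))
  where open BijectionInverse {G} {G} f-bijective

module K = FinGroup Klein

klein-x∙x≡ε : ∀ k → k K.∙ k ≡ K.ε
klein-x∙x≡ε = IsGroup.inverseʳ K.isGroup

klein-fourth≡∙ : ∀ p q s → p ≢ K.ε → q ≢ K.ε → p ≢ q → s ≢ K.ε → s ≢ p → s ≢ q → s ≡ p K.∙ q
klein-fourth≡∙ (false , false) _ _ p≢ε _ _ _ _ _ = contradiction refl p≢ε
klein-fourth≡∙ _ (false , false) _ _ q≢ε _ _ _ _ = contradiction refl q≢ε
klein-fourth≡∙ _ _ (false , false) _ _ _ s≢ε _ _ = contradiction refl s≢ε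
klein-fourth≡∙ (false , true) (false , true) _ _ _ p≢q _ _ _ = contradiction refl p≢q
klein-fourth≡∙ (true , false) (true , false) _ _ _ p≢q _ _ _ = contradiction refl p≢q
klein-fourth≡∙ (true , true)  (true , true)  _ _ _ p≢q _ _ _ = contradiction refl p≢q
klein-fourth≡∙ (false , true) (true , false) (false , true) _ _ _ _ s≢p _ = contradiction refl s≢p
klein-fourth≡∙ (false , true) (true , false) (true , false) _ _ _ _ _ s≢q = contradiction refl s≢q
klein-fourth≡∙ (false , true) (true , false) (true , true)  _ _ _ _ _ _   = refl
klein-fourth≡∙ (false , true) (true , true)  (false , true) _ _ _ _ s≢p _ = contradiction refl s≢p
klein-fourth≡∙ (false , true) (true , true)  (true , false) _ _ _ _ _ _   = refl
klein-fourth≡∙ (false , true) (true , true)  (true , true)  _ _ _ _ _ s≢q = contradiction refl s≢q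
klein-fourth≡∙ (true , false) (false , true) (false , true) _ _ _ _ _ s≢q = contradiction refl s≢q
klein-fourth≡∙ (true , false) (false , true) (true , false) _ _ _ _ s≢p _ = contradiction refl s≢p
klein-fourth≡∙ (true , false) (false , true) (true , true)  _ _ _ _ _ _   = refl
klein-fourth≡∙ (true , false) (true , true)  (false , true) _ _ _ _ _ _   = refl
klein-fourth≡∙ (true , false) (true , true)  (true , false) _ _ _ _ s≢p _ = contradiction refl s≢p
klein-fourth≡∙ (true , false) (true , true)  (true , true)  _ _ _ _ _ s≢q = contradiction refl s≢q
klein-fourth≡∙ (true , true)  (false , true) (false , true) _ _ _ _ _ s≢q = contradiction refl s≢q
klein-fourth≡∙ (true , true)  (false , true) (true , false) _ _ _ _ _ _   = refl
klein-fourth≡∙ (true , true)  (false , true) (true , true)  _ _ _ _ s≢p _ = contradiction refl s≢p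
klein-fourth≡∙ (true , true)  (true , false) (false , true) _ _ _ _ _ _   = refl
klein-fourth≡∙ (true , true)  (true , false) (true , false) _ _ _ _ _ s≢q = contradiction refl s≢q
klein-fourth≡∙ (true , true)  (true , false) (true , true)  _ _ _ _ s≢p _ = contradiction refl s≢p

klein-another-nonzero : ∀ k → ∃ λ l → l ≢ K.ε × l ≢ k
klein-another-nonzero (false , false) = (false , true) , (λ ()) , (λ ())
klein-another-nonzero (false , true)  = (true , false) , (λ ()) , (λ ())
klein-another-nonzero (true , false)  = (false , true) , (λ ()) , (λ ())
klein-another-nonzero (true , true)   = (false , true) , (λ ()) , (λ ())

module KleinBasis (G : FinGroup) (x∙x≡ε : ∀ x → FinGroup._∙_ G x x ≡ FinGroup.ε G) where
  open FinGroup G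
  open FinGroupProperties G
  open Exponent2 x∙x≡ε

  powᵇ : Carrier → Bool → Carrier
  powᵇ z false = ε
  powᵇ z true  = z

  powᵇ-xor : ∀ z p q → powᵇ z (p xor q) ≡ powᵇ z p ∙ powᵇ z q
  powᵇ-xor z false q     = sym (identityˡ (powᵇ z q))
  powᵇ-xor z true  false = sym (identityʳ z)
  powᵇ-xor z true  true  = sym (x∙x≡ε z)

  module _ {a b} (a≢ε : a ≢ ε) (b≢ε : b ≢ ε) (a≢b : a ≢ b)
           (spans : ∀ d → d ≡ ε ⊎ d ≡ a ⊎ d ≡ b ⊎ d ≡ a ∙ b) where

    ψ : K.Carrier → Carrier
    ψ (p , q) = powᵇ a p ∙ powᵇ b q

    ψ-hom : Homomorphic Klein G ψ
    ψ-hom (p , q) (r , s) = begin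
      powᵇ a (p xor r) ∙ powᵇ b (q xor s)                    ≡⟨ cong₂ _∙_ (powᵇ-xor a p r) (powᵇ-xor b q s) ⟩
      (powᵇ a p ∙ powᵇ a r) ∙ (powᵇ b q ∙ powᵇ b s)          ≡⟨ interchange _ _ _ _ ⟩
      (powᵇ a p ∙ powᵇ b q) ∙ (powᵇ a r ∙ powᵇ b s)          ∎
      where open ≡-Reasoning

    ψ-kernel : ∀ k → ψ k ≡ ε → k ≡ K.ε
    ψ-kernel (false , false) _   = refl
    ψ-kernel (true , false)  a≡ε = contradiction (trans (sym (identityʳ a)) a≡ε) a≢ε
    ψ-kernel (false , true)  b≡ε = contradiction (trans (sym (identityˡ b)) b≡ε) b≢ε
    ψ-kernel (true , true)   ab≡ε = contradiction (∙≡ε⇒≡ ab≡ε) a≢b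

    ψ-injective : Injective _≡_ _≡_ ψ
    ψ-injective {k} {l} ψk≡ψl = FinGroupProperties.Exponent2.∙≡ε⇒≡ Klein klein-x∙x≡ε (ψ-kernel (k K.∙ l) (begin
      ψ (k K.∙ l)   ≡⟨ ψ-hom k l ⟩
      ψ k ∙ ψ l     ≡⟨ cong (_∙ ψ l) ψk≡ψl ⟩
      ψ l ∙ ψ l     ≡⟨ x∙x≡ε (ψ l) ⟩
      ε             ∎))
      where open ≡-Reasoning

    ψ-strictlySurjective : StrictlySurjective _≡_ ψ
    ψ-strictlySurjective d with spans d
    ... | inj₁ refl                = (false , false) , identityˡ ε
    ... | inj₂ (inj₁ refl)         = (true , false)  , identityʳ a
    ... | inj₂ (inj₂ (inj₁ refl))  = (false , true)  , identityˡ b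
    ... | inj₂ (inj₂ (inj₂ refl))  = (true , true)   , refl

    ≅Klein : G ≅ Klein
    ≅Klein = ≅-sym {Klein} {G} (ψ , (ψ-injective , strictlySurjective⇒surjective ψ-strictlySurjective) , ψ-hom)

module EqualAutomorphisms (G : FinGroup) (aut-eq : ∀ f → FinGroup.IsGroupAut G f ⇔ FinGroup.IsGraphAut G f) where
  open FinGroup G
  open FinGroupProperties G

  transpose-groupAut : ∀ {u v} → u ≢ v → Twins u v → IsGroupAut (transpose u v)
  transpose-groupAut u≢v twins = Equivalence.from (aut-eq _) (transpose-graphAut u≢v twins)

  -- Otherwise ε and u are twins, and transposing them does not fix ε.
  not-cyclic : ∀ {u} → u ≢ ε → ¬ (∀ y → y ∈⟨ u ⟩)
  not-cyclic {u} u≢ε generates =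
    u≢ε (trans (sym (transpose-u ε u)) (hom-ε {G} {G} (proj₂ (transpose-groupAut (u≢ε ∘ sym) twins))))
    where
    twins : Twins ε u
    twins = dominating-twins ε-dominating (generator-dominating generates)

  module _ {x} (x≢x⁻¹ : x ≢ x ⁻¹) where
    private
      τ : Carrier → Carrier
      τ = transpose x (x ⁻¹)

      τ-hom : Homomorphic G G τ
      τ-hom = proj₂ (transpose-groupAut x≢x⁻¹ (inverse-twins x))

    -- τ fixes every y outside {x, x⁻¹}; if it also fixed x ∙ y, then x ∙ y ≡ τ x ∙ y ≡ x⁻¹ ∙ y.
    ≢⁻¹⇒generates : ∀ y → y ∈⟨ x ⟩
    ≢⁻¹⇒generates y with y ≟ x | y ≟ x ⁻¹ | x ∙ y ≟ x | x ∙ y ≟ x ⁻¹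
    ... | yes refl | _        | _        | _           = ∈⟨self⟩ x
    ... | no _     | yes refl | _        | _           = ⁻¹∈⟨⟩ (∈⟨self⟩ x)
    ... | no _     | no _     | yes xy≡x | _           =
      subst (_∈⟨ x ⟩) (sym (identityʳ-unique x y xy≡x)) ε∈⟨⟩
    ... | no _     | no _     | no _     | yes xy≡x⁻¹ =
      subst (_∈⟨ x ⟩) (sym (y≈x\\z x y (x ⁻¹) xy≡x⁻¹)) (∙∈⟨⟩ (⁻¹∈⟨⟩ (∈⟨self⟩ x)) (⁻¹∈⟨⟩ (∈⟨self⟩ x)))
    ... | no y≢x   | no y≢x⁻¹ | no xy≢x  | no xy≢x⁻¹   = contradiction (∙-cancelʳ y x (x ⁻¹) (begin
      x ∙ y         ≡⟨ transpose-other xy≢x xy≢x⁻¹ ⟨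
      τ (x ∙ y)     ≡⟨ τ-hom x y ⟩
      τ x ∙ τ y     ≡⟨ cong₂ _∙_ (transpose-u x (x ⁻¹)) (transpose-other y≢x y≢x⁻¹) ⟩
      x ⁻¹ ∙ y      ∎)) x≢x⁻¹
      where open ≡-Reasoning

  x∙x≡ε : ∀ x → x ∙ x ≡ ε
  x∙x≡ε x = trans (cong (x ∙_) x≡x⁻¹) (inverseʳ x)
    where
    x≡x⁻¹ : x ≡ x ⁻¹
    x≡x⁻¹ = decidable-stable (x ≟ x ⁻¹) λ x≢x⁻¹ → not-cyclic (x≢x⁻¹⇒x≢ε x≢x⁻¹) (≢⁻¹⇒generates x≢x⁻¹)

  open Exponent2 x∙x≡ε

  ≅Klein : NonTrivial → G ≅ Klein
  ≅Klein (a , a≢ε) = KleinBasis.≅Klein G x∙x≡ε a≢ε b≢ε (b≢a ∘ sym) spans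
    where
    outside-⟨a⟩ : ∃ λ b → ¬ (b ≡ ε ⊎ b ≡ a)
    outside-⟨a⟩ = ¬∀⇒∃¬ (λ y → y ≟ ε ⊎-dec y ≟ a) λ inside →
      not-cyclic a≢ε (ε⊎self∈⟨⟩ ∘ inside)

    b : Carrier
    b = proj₁ outside-⟨a⟩

    b≢ε : b ≢ ε
    b≢ε = proj₂ outside-⟨a⟩ ∘ inj₁

    b≢a : b ≢ a
    b≢a = proj₂ outside-⟨a⟩ ∘ inj₂

    -- A fifth element d could be transposed with a ∙ b, fixing a and b but not a ∙ b.
    spans : ∀ d → d ≡ ε ⊎ d ≡ a ⊎ d ≡ b ⊎ d ≡ a ∙ b
    spans d with d ≟ ε | d ≟ a | d ≟ b | d ≟ a ∙ b
    ... | yes d≡ε | _       | _       | _        = inj₁ d≡ε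
    ... | no _    | yes d≡a | _       | _        = inj₂ (inj₁ d≡a)
    ... | no _    | no _    | yes d≡b | _        = inj₂ (inj₂ (inj₁ d≡b))
    ... | no _    | no _    | no _    | yes d≡ab = inj₂ (inj₂ (inj₂ d≡ab))
    ... | no d≢ε  | no d≢a  | no d≢b  | no d≢ab  = contradiction (begin
      d                   ≡⟨ transpose-u (a ∙ b) d ⟨
      τ (a ∙ b)           ≡⟨ τ-hom a b ⟩
      τ a ∙ τ b           ≡⟨ cong₂ _∙_ (transpose-other (x∙y≢x b≢ε ∘ sym) (d≢a ∘ sym))
                                            (transpose-other (x∙y≢y a≢ε ∘ sym) (d≢b ∘ sym)) ⟩
      a ∙ b               ∎) d≢ab
      where
      open ≡-Reasoning

      τ : Carrier → Carrier
      τ = transpose (a ∙ b) d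

      τ-hom : Homomorphic G G τ
      τ-hom = proj₂ (transpose-groupAut (d≢ab ∘ sym) (nonidentity-twins (x∙y≢ε (b≢a ∘ sym)) d≢ε))

module KleinIsomorphic (G : FinGroup) (iso : G ≅ Klein) where
  open FinGroup G
  open FinGroupProperties G

  private
    φ : Carrier → K.Carrier
    φ = proj₁ iso

    φ-bijective : Bijective _≡_ _≡_ φ
    φ-bijective = proj₁ (proj₂ iso)

    φ-injective : Injective _≡_ _≡_ φ
    φ-injective = proj₁ φ-bijective

    φ-hom : Homomorphic G Klein φ
    φ-hom = proj₂ (proj₂ iso)

    φε≡ε : φ ε ≡ K.ε
    φε≡ε = hom-ε {G} {Klein} {φ} φ-hom

    φ-≢ : ∀ {x y} → x ≢ y → φ x ≢ φ y
    φ-≢ x≢y = x≢y ∘ φ-injective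

    open BijectionInverse {G} {Klein} φ-bijective

  x∙x≡ε : ∀ x → x ∙ x ≡ ε
  x∙x≡ε x = φ-injective (trans (φ-hom x x) (trans (klein-x∙x≡ε (φ x)) (sym φε≡ε)))

  open Exponent2 x∙x≡ε

  fourth≡∙ : ∀ {p q s} → p ≢ ε → q ≢ ε → p ≢ q → s ≢ ε → s ≢ p → s ≢ q → s ≡ p ∙ q
  fourth≡∙ p≢ε q≢ε p≢q s≢ε s≢p s≢q = φ-injective (trans
    (klein-fourth≡∙ _ _ _ (φ-≢ε p≢ε) (φ-≢ε q≢ε) (φ-≢ p≢q) (φ-≢ε s≢ε) (φ-≢ s≢p) (φ-≢ s≢q))
    (sym (φ-hom _ _)))
    where
    φ-≢ε : ∀ {x} → x ≢ ε → φ x ≢ K.ε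
    φ-≢ε = hom-≢ε {G} {Klein} {φ} φ-hom φ-injective

  another-nonidentity : ∀ u → ∃ λ v → v ≢ ε × v ≢ u
  another-nonidentity u with klein-another-nonzero (φ u)
  ... | l , l≢ε , l≢φu =
    φ⁻¹ l , (λ φ⁻¹l≡ε → l≢ε (trans (sym (φ∘φ⁻¹ l)) (trans (cong φ φ⁻¹l≡ε) φε≡ε)))
          , (λ φ⁻¹l≡u → l≢φu (trans (sym (φ∘φ⁻¹ l)) (cong φ φ⁻¹l≡u)))

  graphAut⇒groupAut : ∀ {f} → IsGraphAut f → IsGroupAut f
  graphAut⇒groupAut {f} f-graphAut@(f-bijective , _) = f-bijective , f-hom
    where
    -- f ε dominates the graph, and in an exponent-2 group only ε does.
    fε≡ε : f ε ≡ ε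
    fε≡ε with another-nonidentity (f ε)
    ... | v , v≢ε , v≢fε = dominating⇒ε (graphAut-dominating f-graphAut ε-dominating) v≢ε v≢fε

    f-≢ : ∀ {x y} → x ≢ y → f x ≢ f y
    f-≢ x≢y = x≢y ∘ proj₁ f-bijective

    f-≢ε : ∀ {x} → x ≢ ε → f x ≢ ε
    f-≢ε x≢ε fx≡ε = f-≢ x≢ε (trans fx≡ε (sym fε≡ε))

    f-hom : ∀ x y → f (x ∙ y) ≡ f x ∙ f y
    f-hom x y with x ≟ ε | y ≟ ε | x ≟ y
    ... | yes refl | _        | _        = begin
      f (ε ∙ y)    ≡⟨ cong f (identityˡ y) ⟩
      f y          ≡⟨ identityˡ (f y) ⟨
      ε ∙ f y      ≡⟨ cong (_∙ f y) fε≡ε ⟨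
      f ε ∙ f y    ∎
      where open ≡-Reasoning
    ... | no _     | yes refl | _        = begin
      f (x ∙ ε)    ≡⟨ cong f (identityʳ x) ⟩
      f x          ≡⟨ identityʳ (f x) ⟨
      f x ∙ ε      ≡⟨ cong (f x ∙_) fε≡ε ⟨
      f x ∙ f ε    ∎
      where open ≡-Reasoning
    ... | no _     | no _     | yes refl =
      trans (cong f (x∙x≡ε x)) (trans fε≡ε (sym (x∙x≡ε (f x))))
    ... | no x≢ε   | no y≢ε   | no x≢y   =
      fourth≡∙ (f-≢ε x≢ε) (f-≢ε y≢ε) (f-≢ x≢y) (f-≢ε (x∙y≢ε x≢y)) (f-≢ (x∙y≢x y≢ε)) (f-≢ (x∙y≢y x≢ε))

mainTheorem9 : (G : FinGroup) → FinGroup.NonTrivial G →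
    ((∀ f → FinGroup.IsGroupAut G f ⇔ FinGroup.IsGraphAut G f) ⇔ (G ≅ Klein))
mainTheorem9 G nontrivial = mk⇔
  (λ aut-eq → EqualAutomorphisms.≅Klein G aut-eq nontrivial)
  (λ iso f → mk⇔ (groupAut⇒graphAut G) (KleinIsomorphic.graphAut⇒groupAut G iso))
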